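{- Let $n$ be a positive integer and $k=\lfloor\log_2 n\rfloor$. The number $\ell(n)$ of long hyperbinary expansions of $n$ equals $b(n-2^k)$.
   Context: A hyperbinary expansion of a positive integer $n$ is a word $x_1\cdots x_h$ over the alphabet $\{0,1,2\}$ with $x_1\neq 0$ and $n=\sum_{i=1}^h x_i2^{h-i}$. Every hyperbinary expansion of $n$ has length $\lfloor\log_2 n\rfloor$ (short) or $\lfloor\log_2 n\rfloor+1$ (long). $b(m)$ denotes the number of hyperbinary expansions of $m$ for $m>0$, and $b(0)=1$. -}

module Defs where

open import Data.Nat using (ℕ; zero; suc; _+_; _*_; _≟_)
open import Data.Fin using (Fin; toℕ)
open import Data.Fin.Base using (zero; suc)
open import Data.List using (List; []; _∷_; length; filter; concatMap; map; foldl; upTo)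
open import Data.Nat.ListAction using (sum)
open import Data.Nat.Logarithm using (⌊log₂_⌋)
open import Data.Product using (_×_)
open import Data.Empty using (⊥)
open import Data.Unit using (⊤)
open import Relation.Nullary using (Dec; yes; no; ¬_)
open import Relation.Nullary.Decidable using (_×-dec_)
open import Relation.Binary.PropositionalEquality using (_≡_)

Digit : Set
Digit = Fin 3

-- Value of a word x₁⋯x_h (most significant digit first): Σ xᵢ 2^(h-i).
value : List Digit → ℕ
value = foldl (λ acc d → 2 * acc + toℕ d) 0

LeadingNonzero : List Digit → Set
LeadingNonzero []            = ⊥
LeadingNonzero (zero  ∷ _)   = ⊥
LeadingNonzero (suc _ ∷ _)   = ⊤

leadingNonzero? : (w : List Digit) → Dec (LeadingNonzero w)
leadingNonzero? []          = no (λ ())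
leadingNonzero? (zero  ∷ _) = no (λ ())
leadingNonzero? (suc _ ∷ _) = yes _

IsHyperbinaryExpansion : ℕ → List Digit → Set
IsHyperbinaryExpansion n w = LeadingNonzero w × value w ≡ n

isHyperbinaryExpansion? : (n : ℕ) (w : List Digit) → Dec (IsHyperbinaryExpansion n w)
isHyperbinaryExpansion? n w = leadingNonzero? w ×-dec (value w ≟ n)

allDigits : List Digit
allDigits = zero ∷ suc zero ∷ suc (suc zero) ∷ []

words : ℕ → List (List Digit)
words zero    = [] ∷ []
words (suc h) = concatMap (λ d → map (d ∷_) (words h)) allDigits

expansionsOfLength : ℕ → ℕ → ℕ
expansionsOfLength n h = length (filter (isHyperbinaryExpansion? n) (words h))

-- b(m): number of hyperbinary expansions of m for m > 0, and b(0) = 1.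
-- For m > 0 every expansion x₁⋯x_h has x₁ ≥ 1, so m ≥ 2^(h-1) and hence
-- h ≤ m; counting lengths 0..m therefore counts all expansions.
b : ℕ → ℕ
b zero        = 1
b m@(suc _)   = sum (map (expansionsOfLength m) (upTo (suc m)))

ℓ : ℕ → ℕ
ℓ n = expansionsOfLength n (suc ⌊log₂ n ⌋)

module Submission where

-- A long expansion of n, of length k + 1 with k = ⌊log₂ n⌋, cannot start with 2 since n < 2^(k+1);
-- so it is 1 followed by an arbitrary word w of length k with value r = n − 2^k, leading zeros
-- allowed. Since r < 2^k, no expansion of r is longer than k, and stripping the leading zeros of w
-- is a bijection onto all expansions of r (onto the empty word when r = 0).

open import Defs
open import Data.Bool using (true; false)
open import Data.Fin using (Fin; toℕ)
open import Data.Fin.Base using (zero; suc)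
open import Data.List using (List; []; _∷_; [_]; _++_; _∷ʳ_; length; filter; map; concatMap; foldl; upTo)
open import Data.List.Properties using (filter-++; filter-none; length-++; map-++; applyUpTo-∷ʳ)
open import Data.List.Relation.Unary.All as All using (All; []; _∷_)
open import Data.List.Relation.Unary.All.Properties using (map⁺; concat⁺)
open import Data.Nat using (ℕ; zero; suc; _+_; _*_; _∸_; _^_; _≤_; _<_; z≤n; s≤s; _≟_; _≤?_; ⌊_/2⌋; ⌈_/2⌉)
open import Data.Nat.Induction using (<-wellFounded)
open import Data.Nat.ListAction using (sum)
open import Data.Nat.ListAction.Properties using (sum-++)
open import Data.Nat.Logarithm using (⌊log₂_⌋; ⌊log₂⌋-mono-≤; ⌊log₂[2^n]⌋≡n)
open import Data.Nat.Logarithm.Core using (⌊log2⌋)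
open import Data.Nat.Properties
open import Data.Nat.Solver using (module +-*-Solver)
open import Data.Product using (proj₁; proj₂; _,_)
open import Data.Unit using (tt)
open import Function using (_∘_; id)
open import Function.Bundles using (_⇔_; mk⇔; Equivalence)
open import Induction.WellFounded using (Acc; acc)
open import Level using (0ℓ)
open import Relation.Binary.PropositionalEquality using (_≡_; _≢_; refl; sym; trans; cong; cong₂; module ≡-Reasoning)
open import Relation.Nullary using (yes; no; does; contradiction)
open import Relation.Unary using (Pred; Decidable; ∁)
open +-*-Solver using (solve; _:=_; _:+_; _:*_; con)

count : {A : Set} {P : Pred A 0ℓ} → Decidable P → List A → ℕ
count P? = length ∘ filter P?

module _ {A : Set} {P : Pred A 0ℓ} (P? : Decidable P) where

  count-++ : (xs ys : List A) → count P? (xs ++ ys) ≡ count P? xs + count P? ys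
  count-++ xs ys = trans (cong length (filter-++ P? xs ys)) (length-++ (filter P? xs))

  count-map : {B : Set} (f : B → A) (xs : List B) → count P? (map f xs) ≡ count (P? ∘ f) xs
  count-map f []       = refl
  count-map f (x ∷ xs) with does (P? (f x))
  ... | true  = cong suc (count-map f xs)
  ... | false = count-map f xs

  count-none : {xs : List A} → All (∁ P) xs → count P? xs ≡ 0
  count-none ¬Pxs = cong length (filter-none P? ¬Pxs)

  count-cong : {Q : Pred A 0ℓ} (Q? : Decidable Q) {xs : List A} →
               All (λ x → P x ⇔ Q x) xs → count P? xs ≡ count Q? xs
  count-cong Q? {[]}     []             = refl
  count-cong Q? {x ∷ xs} (P⇔Q ∷ P⇔Qs) with P? x | Q? x
  ... | yes _  | yes _  = cong suc (count-cong Q? P⇔Qs)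
  ... | no _   | no _   = count-cong Q? P⇔Qs
  ... | yes px | no ¬qx = contradiction (Equivalence.to P⇔Q px) ¬qx
  ... | no ¬px | yes qx = contradiction (Equivalence.from P⇔Q qx) ¬px

count-words-suc : {P : Pred (List Digit) 0ℓ} (P? : Decidable P) (h : ℕ) →
                  count P? (words (suc h)) ≡ sum (map (λ d → count (P? ∘ (d ∷_)) (words h)) allDigits)
count-words-suc P? h = count-concatMap allDigits
  where
  count-concatMap : (ds : List Digit) →
                    count P? (concatMap (λ d → map (d ∷_) (words h)) ds)
                      ≡ sum (map (λ d → count (P? ∘ (d ∷_)) (words h)) ds)
  count-concatMap []       = refl
  count-concatMap (d ∷ ds) = trans (count-++ P? (map (d ∷_) (words h)) _)
                                   (cong₂ _+_ (count-map P? (d ∷_) (words h)) (count-concatMap ds))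

words-length : (h : ℕ) → All (λ w → length w ≡ h) (words h)
words-length zero    = refl ∷ []
words-length (suc h) =
  concat⁺ (map⁺ (All.universal (λ d → map⁺ {f = d ∷_} (All.map (cong suc) (words-length h))) allDigits))

value-foldl : (a : ℕ) (w : List Digit) →
              foldl (λ acc d → 2 * acc + toℕ d) a w ≡ a * 2 ^ length w + value w
value-foldl a []      = sym (trans (+-identityʳ (a * 1)) (*-identityʳ a))
value-foldl a (d ∷ w) = begin
  foldl _ (2 * a + toℕ d) w                   ≡⟨ value-foldl (2 * a + toℕ d) w ⟩
  (2 * a + toℕ d) * 2 ^ length w + value w    ≡⟨ solve 4 (λ a d p v → (con 2 :* a :+ d) :* p :+ v
                                                   := a :* (con 2 :* p) :+ (d :* p :+ v)) refl a (toℕ d) (2 ^ length w) (value w) ⟩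
  a * 2 ^ length (d ∷ w) + (toℕ d * 2 ^ length w + value w)
                                              ≡⟨ cong (a * 2 ^ length (d ∷ w) +_) (sym (value-foldl (toℕ d) w)) ⟩
  a * 2 ^ length (d ∷ w) + value (d ∷ w)      ∎
  where open ≡-Reasoning

value-∷ : (d : Digit) (w : List Digit) → value (d ∷ w) ≡ toℕ d * 2 ^ length w + value w
value-∷ d = value-foldl (toℕ d)

m+n≡o⇔n≡o∸m : {m n o : ℕ} → m ≤ o → (m + n ≡ o) ⇔ (n ≡ o ∸ m)
m+n≡o⇔n≡o∸m {m} {n} m≤o = mk⇔ (λ m+n≡o → trans (sym (m+n∸m≡n m n)) (cong (_∸ m) m+n≡o))
                              (λ n≡o∸m → trans (cong (m +_) n≡o∸m) (m+[n∸m]≡n m≤o))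

paddedExpansions : ℕ → ℕ → ℕ
paddedExpansions n h = count (λ w → value w ≟ n) (words h)

expansionsStartingWith : Digit → ℕ → ℕ → ℕ
expansionsStartingWith d n h = count (λ w → value (d ∷ w) ≟ n) (words h)

expansionsOfLength-suc : (n h : ℕ) → expansionsOfLength n (suc h)
                         ≡ expansionsStartingWith (suc zero) n h + expansionsStartingWith (suc (suc zero)) n h
expansionsOfLength-suc n h = trans (count-words-suc (isHyperbinaryExpansion? n) h)
  (cong₂ _+_ (count-none _ (All.universal (λ _ → proj₁) (words h)))
             (cong₂ _+_ (nonzeroLeading zero) (trans (+-identityʳ _) (nonzeroLeading (suc zero)))))
  where
  nonzeroLeading : (d : Fin 2) → count (isHyperbinaryExpansion? n ∘ (suc d ∷_)) (words h)
                                  ≡ expansionsStartingWith (suc d) n h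
  nonzeroLeading d = count-cong _ _ (All.universal (λ _ → mk⇔ proj₂ (tt ,_)) (words h))

paddedExpansions-suc : (n h : ℕ) → paddedExpansions n (suc h) ≡ paddedExpansions n h + expansionsOfLength n (suc h)
paddedExpansions-suc n h = trans (count-words-suc (λ w → value w ≟ n) h)
  (cong (paddedExpansions n h +_)
        (trans (cong (expansionsStartingWith (suc zero) n h +_) (+-identityʳ _)) (sym (expansionsOfLength-suc n h))))

expansionsStartingWith-≡0 : (d : Digit) (n h : ℕ) → n < toℕ d * 2 ^ h → expansionsStartingWith d n h ≡ 0
expansionsStartingWith-≡0 d n h n<d2^h = count-none _ (All.map (λ {w} → tooLarge {w}) (words-length h))
  where
  tooLarge : {w : List Digit} → length w ≡ h → value (d ∷ w) ≢ n
  tooLarge {w} refl value≡n = <⇒≱ n<d2^h (begin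
    toℕ d * 2 ^ length w             ≤⟨ m≤m+n _ (value w) ⟩
    toℕ d * 2 ^ length w + value w   ≡⟨ sym (value-∷ d w) ⟩
    value (d ∷ w)                    ≡⟨ value≡n ⟩
    n                                ∎)
    where open ≤-Reasoning

expansionsStartingWith-≡padded : (d : Digit) (n h : ℕ) → toℕ d * 2 ^ h ≤ n →
                                 expansionsStartingWith d n h ≡ paddedExpansions (n ∸ toℕ d * 2 ^ h) h
expansionsStartingWith-≡padded d n h d2^h≤n = count-cong _ _ (All.map (λ {w} → dropLeading {w}) (words-length h))
  where
  dropLeading : {w : List Digit} → length w ≡ h → (value (d ∷ w) ≡ n) ⇔ (value w ≡ n ∸ toℕ d * 2 ^ h)
  dropLeading {w} refl = mk⇔ (λ e → to (trans (sym (value-∷ d w)) e)) (λ e → trans (value-∷ d w) (from e))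
    where open Equivalence (m+n≡o⇔n≡o∸m d2^h≤n)

expansionsOfLength-≡0 : (n h : ℕ) → n < 2 ^ h → expansionsOfLength n (suc h) ≡ 0
expansionsOfLength-≡0 n h n<2^h = trans (expansionsOfLength-suc n h)
  (cong₂ _+_ (expansionsStartingWith-≡0 (suc zero) n h (<-≤-trans n<2^h (≤-reflexive (sym (*-identityˡ _)))))
             (expansionsStartingWith-≡0 (suc (suc zero)) n h (<-≤-trans n<2^h (m≤m+n _ _))))

paddedExpansions-stable : (n h d : ℕ) → n < 2 ^ h → paddedExpansions n (d + h) ≡ paddedExpansions n h
paddedExpansions-stable n h zero    _     = refl
paddedExpansions-stable n h (suc d) n<2^h = begin
  paddedExpansions n (suc d + h)                                   ≡⟨ paddedExpansions-suc n (d + h) ⟩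
  paddedExpansions n (d + h) + expansionsOfLength n (suc (d + h))  ≡⟨ cong (paddedExpansions n (d + h) +_)
                                                                        (expansionsOfLength-≡0 n (d + h) n<2^[d+h]) ⟩
  paddedExpansions n (d + h) + 0                                   ≡⟨ +-identityʳ _ ⟩
  paddedExpansions n (d + h)                                       ≡⟨ paddedExpansions-stable n h d n<2^h ⟩
  paddedExpansions n h                                             ∎
  where
  open ≡-Reasoning
  n<2^[d+h] : n < 2 ^ (d + h)
  n<2^[d+h] = <-≤-trans n<2^h (^-monoʳ-≤ 2 (m≤n+m h d))

paddedExpansions-irrelevant : (n h h′ : ℕ) → n < 2 ^ h → n < 2 ^ h′ → paddedExpansions n h ≡ paddedExpansions n h′
paddedExpansions-irrelevant n h h′ n<2^h n<2^h′ = begin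
  paddedExpansions n h         ≡⟨ sym (paddedExpansions-stable n h h′ n<2^h) ⟩
  paddedExpansions n (h′ + h)  ≡⟨ cong (paddedExpansions n) (+-comm h′ h) ⟩
  paddedExpansions n (h + h′)  ≡⟨ paddedExpansions-stable n h′ h n<2^h′ ⟩
  paddedExpansions n h′        ∎
  where open ≡-Reasoning

sum-map-upTo-suc : (f : ℕ → ℕ) (h : ℕ) → sum (map f (upTo (suc h))) ≡ sum (map f (upTo h)) + f h
sum-map-upTo-suc f h = begin
  sum (map f (upTo (suc h)))        ≡⟨ cong (sum ∘ map f) (sym (applyUpTo-∷ʳ id h)) ⟩
  sum (map f (upTo h ∷ʳ h))         ≡⟨ cong sum (map-++ f (upTo h) [ h ]) ⟩
  sum (map f (upTo h) ++ [ f h ])   ≡⟨ sum-++ (map f (upTo h)) [ f h ] ⟩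
  sum (map f (upTo h)) + (f h + 0)  ≡⟨ cong (sum (map f (upTo h)) +_) (+-identityʳ (f h)) ⟩
  sum (map f (upTo h)) + f h        ∎
  where open ≡-Reasoning

-- A word of positive value is a block of leading zeros followed by an expansion.
paddedExpansions-sum : (r h : ℕ) → paddedExpansions (suc r) h ≡ sum (map (expansionsOfLength (suc r)) (upTo (suc h)))
paddedExpansions-sum r zero    = refl
paddedExpansions-sum r (suc h) = begin
  paddedExpansions (suc r) (suc h)                                         ≡⟨ paddedExpansions-suc (suc r) h ⟩
  paddedExpansions (suc r) h + expansionsOfLength (suc r) (suc h)           ≡⟨ cong (_+ expansionsOfLength (suc r) (suc h))
                                                                                 (paddedExpansions-sum r h) ⟩
  sum (map (expansionsOfLength (suc r)) (upTo (suc h))) + expansionsOfLength (suc r) (suc h)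
                                                                            ≡⟨ sym (sum-map-upTo-suc (expansionsOfLength (suc r)) (suc h)) ⟩
  sum (map (expansionsOfLength (suc r)) (upTo (suc (suc h))))              ∎
  where open ≡-Reasoning

n<2^n : (n : ℕ) → n < 2 ^ n
n<2^n zero    = s≤s z≤n
n<2^n (suc n) = +-mono-≤-< (m^n>0 2 n) (<-≤-trans (n<2^n n) (≤-reflexive (sym (+-identityʳ _))))

paddedExpansions≡b : (n h : ℕ) → n < 2 ^ h → paddedExpansions n h ≡ b n
paddedExpansions≡b zero    h n<2^h = paddedExpansions-irrelevant 0 h 0 n<2^h (s≤s z≤n)
paddedExpansions≡b (suc r) h n<2^h = trans (paddedExpansions-irrelevant (suc r) h (suc r) n<2^h (n<2^n (suc r)))
                                         (paddedExpansions-sum r (suc r))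

2^⌊log₂[1+n]⌋≤1+n : (n : ℕ) → 2 ^ ⌊log₂ suc n ⌋ ≤ suc n
2^⌊log₂[1+n]⌋≤1+n n = go n (<-wellFounded (suc n))
  where
  -- recursion along the accessibility proof on which ⌊log₂_⌋ itself recurses
  go : (n : ℕ) (a : Acc _<_ (suc n)) → 2 ^ ⌊log2⌋ (suc n) a ≤ suc n
  go zero    _        = s≤s z≤n
  go (suc n) (acc rs) = begin
    2 * 2 ^ ⌊log2⌋ (suc ⌊ n /2⌋) (rs (⌊n/2⌋<n (suc n)))  ≤⟨ *-monoʳ-≤ 2 (go ⌊ n /2⌋ (rs (⌊n/2⌋<n (suc n)))) ⟩
    2 * suc ⌊ n /2⌋                                       ≡⟨ *-suc 2 ⌊ n /2⌋ ⟩
    2 + 2 * ⌊ n /2⌋                                       ≤⟨ +-monoʳ-≤ 2 (+-monoʳ-≤ ⌊ n /2⌋ ⌊n/2⌋+0≤⌈n/2⌉) ⟩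
    2 + (⌊ n /2⌋ + ⌈ n /2⌉)                               ≡⟨ cong (2 +_) (⌊n/2⌋+⌈n/2⌉≡n n) ⟩
    suc (suc n)                                           ∎
    where
    open ≤-Reasoning
    ⌊n/2⌋+0≤⌈n/2⌉ : ⌊ n /2⌋ + 0 ≤ ⌈ n /2⌉
    ⌊n/2⌋+0≤⌈n/2⌉ = ≤-trans (≤-reflexive (+-identityʳ _)) (⌊n/2⌋≤⌈n/2⌉ n)

n<2^[1+⌊log₂n⌋] : (n : ℕ) → n < 2 ^ suc ⌊log₂ n ⌋
n<2^[1+⌊log₂n⌋] n with 2 ^ suc ⌊log₂ n ⌋ ≤? n
... | no  2^[1+k]≰n = ≰⇒> 2^[1+k]≰n
... | yes 2^[1+k]≤n = contradiction (⌊log₂⌋-mono-≤ 2^[1+k]≤n) (<⇒≱ (≤-reflexive (sym (⌊log₂[2^n]⌋≡n (suc ⌊log₂ n ⌋)))))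

corollary4p3 : (m : ℕ) → ℓ (suc m) ≡ b (suc m ∸ 2 ^ ⌊log₂ suc m ⌋)
corollary4p3 m = begin
  ℓ n                                           ≡⟨ expansionsOfLength-suc n k ⟩
  expansionsStartingWith (suc zero) n k + expansionsStartingWith (suc (suc zero)) n k
                                                ≡⟨ cong₂ _+_ (expansionsStartingWith-≡padded (suc zero) n k 1*2^k≤n)
                                                             (expansionsStartingWith-≡0 (suc (suc zero)) n k (n<2^[1+⌊log₂n⌋] n)) ⟩
  paddedExpansions (n ∸ 1 * 2 ^ k) k + 0        ≡⟨ +-identityʳ _ ⟩
  paddedExpansions (n ∸ 1 * 2 ^ k) k            ≡⟨ cong (λ x → paddedExpansions (n ∸ x) k) (*-identityˡ (2 ^ k)) ⟩
  paddedExpansions (n ∸ 2 ^ k) k                ≡⟨ paddedExpansions≡b (n ∸ 2 ^ k) k n∸2^k<2^k ⟩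
  b (n ∸ 2 ^ k)                                 ∎
  where
  open ≡-Reasoning
  n = suc m
  k = ⌊log₂ n ⌋
  1*2^k≤n : 1 * 2 ^ k ≤ n
  1*2^k≤n = ≤-trans (≤-reflexive (*-identityˡ (2 ^ k))) (2^⌊log₂[1+n]⌋≤1+n m)
  n∸2^k<2^k : n ∸ 2 ^ k < 2 ^ k
  n∸2^k<2^k = m<n+o⇒m∸n<o n (2 ^ k) {{m^n≢0 2 k}}
                (<-≤-trans (n<2^[1+⌊log₂n⌋] n) (≤-reflexive (cong (2 ^ k +_) (+-identityʳ (2 ^ k)))))
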